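{- Let $\rho=v_1,\dots,v_m$ be a play prefix, let $v_{m+1}$ be a vertex with $(v_m,v_{m+1})\in E$, let $\rho'=v_1,\dots,v_{m+1}$ and $d=\phi(v_{m+1})$. Let $\mathbf b=(b_k,\dots,b_0)$ be a colour witness for $\rho$. Suppose $d\in C^-$ is odd and there is an index $j$ such that $b_j\ne\_$, $d\ge b_j$, and for all $i>j$ either $b_i=\_$ or $b_i>d$. Define $\mathbf c=(c_k,\dots,c_0)$ by $c_i=b_i$ for all $i>j$; $c_j=d$ if $j\ne0$ and $c_j=\_$ if $j=0$; and $c_i=\_$ for all $i<j$. Then $\mathbf c$ is a colour witness for $\rho'$.
   Context: A parity game has a finite directed graph $(V,E)$ in which every vertex has a successor and a colouring $\phi:V\to C$, where $C$ is a finite set of positive integers of the form $\{1,\dots,\max C\}$ or $\{2,\dots,\max C\}$; $C^-=C\setminus\{\max C\}$ if $\max C$ is odd and $C^-=C$ otherwise. A play prefix $\rho=v_1,\dots,v_m$ is a path in $(V,E)$; its positions are $1,\dots,m$. Let $\_$ be a blank symbol. $i$-colour witness. For $i\in C^-$ and $\ell\ge0$: if $i$ is even, an $i$-colour witness of length $\ell$ in $\rho$ is a sequence of positions $p_1<\dots<p_\ell$; if $i$ is odd it is $p_0<p_1<\dots<p_\ell$; positions lie in $\{1,\dots,m\}$ and: (evenness) $\phi(v_{p_j})$ is even for every index $j<\ell$ of the sequence, and $\phi(v_{p_\ell})=i$; (inner domination) for consecutive entries $p_j,p_{j+1}$, every $q$ with $p_j\le q\le p_{j+1}$ has $\phi(v_q)\le\max\{\phi(v_{p_j}),\phi(v_{p_{j+1}})\}$;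 (outer domination) $\phi(v_q)\le i$ for all $p_\ell\le q\le m$. Colour witness. A colour witness for $\rho$ is a sequence $\mathbf b=(b_k,\dots,b_0)$ with entries in $C^-\cup\{\_\}$ such that, writing $\mathrm{pos}(i,\mathbf b)=\{j\le k:b_j=i\}$: (order) $b_i\ge b_j$ whenever $i>j$ and $b_i,b_j\ne\_$; (conciseness) for every odd $i\in C^-$, $|\mathrm{pos}(i,\mathbf b)|\le1$ and $b_0\ne i$; and there exist, for every colour $i$ with $\mathrm{pos}(i,\mathbf b)\ne\emptyset$, a number $\ell_i$ and an $i$-colour witness $W_i$ of length $\ell_i$ in $\rho$ such that (ordered witnesses) for colours $i>j$ both occurring in $\mathbf b$, the last position of $W_i$ is strictly smaller than the first position of $W_j$; and (length) for every $i\in C^-$, $\sum_{j\in U(i,\mathbf b)}\ell_j\ge\sum_{p\in P(i,\mathbf b)}2^p$, where $\mathrm{odd}(i,\mathbf b)=\inf\{j>i: j\text{ odd},\ \mathrm{pos}(j,\mathbf b)\ne\emptyset\}$ ($=\infty$ if no such $j$), $U(i,\mathbf b)=\{j: i\le j<\mathrm{odd}(i,\mathbf b),\ \mathrm{pos}(j,\mathbf b)\ne\emptyset\}$, and $P(i,\mathbf b)=\bigcup_{j\in U(i,\mathbf b)}\mathrm{pos}(j,\mathbf b)$. -}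

module Defs where

open import Data.Nat using (ℕ; zero; suc; _+_; _∸_; _^_; _≤_; _<_; _⊔_; _≤ᵇ_; _<ᵇ_; _≡ᵇ_; _%_)
open import Data.Nat.Divisibility using (_∣_)
open import Data.Fin using (Fin; toℕ) renaming (_<_ to _<ᶠ_)
open import Data.Bool using (Bool; true; false; _∧_; _∨_; not; if_then_else_)
open import Data.Maybe using (Maybe; just; nothing)
open import Data.List using (List; []; _∷_; _++_; [_]; length; map; upTo; allFin)
open import Data.Bool.ListAction using (any; all)
open import Data.Nat.ListAction using (sum)
open import Data.List.Relation.Unary.All using (All)
open import Data.List.Relation.Unary.Linked using (Linked)
open import Data.Product using (Σ; ∃; ∃-syntax; _×_; _,_)
open import Data.Sum using (_⊎_)
open import Relation.Nullary using (¬_)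
open import Relation.Binary.PropositionalEquality using (_≡_; _≢_)

Even : ℕ → Set
Even n = 2 ∣ n

Odd : ℕ → Set
Odd n = ¬ Even n

oddᵇ : ℕ → Bool
oddᵇ n = (n % 2) ≡ᵇ 1

record ParityGame : Set₁ where
  field
    n      : ℕ
    E      : Fin n → Fin n → Set
    total  : ∀ v → ∃[ w ] E v w
    minC   : ℕ
    maxC   : ℕ
    minC-1or2 : minC ≡ 1 ⊎ minC ≡ 2
    minC≤maxC : minC ≤ maxC
    φ      : Fin n → ℕ
    φ∈C    : ∀ v → minC ≤ φ v × φ v ≤ maxC

module _ (G : ParityGame) where
  open ParityGame G

  V : Set
  V = Fin n

  InC : ℕ → Set
  InC c = minC ≤ c × c ≤ maxC

  InC⁻ : ℕ → Set
  InC⁻ c = InC c × ¬ (c ≡ maxC × Odd maxC)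

  -- Play prefixes  ρ = v₁,…,v_m  are functions ℕ → V of which only the
  -- positions 1,…,m are relevant.

  IsPlayPrefix : (m : ℕ) → (ℕ → V) → Set
  IsPlayPrefix m ρ = 1 ≤ m × (∀ q → 1 ≤ q → q < m → E (ρ q) (ρ (suc q)))

  extend : (ℕ → V) → ℕ → V → (ℕ → V)
  extend ρ m v q = if q ≤ᵇ m then ρ q else v

  -- i-colour witnesses.  The sequence (p₁,…,p_ℓ) resp. (p₀,…,p_ℓ) is a
  -- list of positions; it has length ℓ if i is even and ℓ+1 if i is odd.

  module _ (m : ℕ) (ρ : ℕ → V) where

    col : ℕ → ℕ
    col q = φ (ρ q)

    Step : ℕ → ℕ → Set
    Step p p' = p < p' × (∀ q → p ≤ q → q ≤ p' → col q ≤ col p ⊔ col p')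

    IsColourWitnessOf : (i ℓ : ℕ) → List ℕ → Set
    IsColourWitnessOf i ℓ ps =
        (Even i → length ps ≡ ℓ)
      × (Odd i → length ps ≡ suc ℓ)
      × All (λ p → 1 ≤ p × p ≤ m) ps
      × Linked Step ps
      × (∀ xs x → ps ≡ xs ++ [ x ] →
           All (λ p → Even (col p)) xs
           × col x ≡ i
           × (∀ q → x ≤ q → q ≤ m → col q ≤ i))

    -- Colour witnesses b = (b_k,…,b_0) : Fin (suc k) → Maybe ℕ,
    -- with  nothing  the blank symbol _.

    module _ (k : ℕ) (b : Fin (suc k) → Maybe ℕ) where

      Occurs : ℕ → Set
      Occurs i = ∃[ p ] b p ≡ just i

      isᵇ : Maybe ℕ → ℕ → Bool
      isᵇ (just c) i = c ≡ᵇ i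
      isᵇ nothing  i = false

      occursᵇ : ℕ → Bool
      occursᵇ i = any (λ p → isᵇ (b p) i) (allFin (suc k))

      -- j < odd(i,b) : no odd colour j' with i < j' ≤ j occurs in b
      belowOddᵇ : ℕ → ℕ → Bool
      belowOddᵇ i j =
        all (λ j' → not ((i <ᵇ j') ∧ oddᵇ j' ∧ occursᵇ j')) (upTo (suc j))

      inUᵇ : ℕ → ℕ → Bool
      inUᵇ i j = occursᵇ j ∧ (i ≤ᵇ j) ∧ belowOddᵇ i j

      -- Σ_{j ∈ U(i,b)} ℓ_j  (all colours in b are ≤ max C)
      lenSum : (ℕ → ℕ) → ℕ → ℕ
      lenSum ℓ i = sum (map (λ j → if inUᵇ i j then ℓ j else 0) (upTo (suc maxC)))

      posTerm : ℕ → Fin (suc k) → ℕ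
      posTerm i p with b p
      ... | just j  = if inUᵇ i j then 2 ^ toℕ p else 0
      ... | nothing = 0

      powSum : ℕ → ℕ
      powSum i = sum (map (posTerm i) (allFin (suc k)))

      IsColourWitness : Set
      IsColourWitness =
          (∀ p c → b p ≡ just c → InC⁻ c)
        × (∀ p q c d → q <ᶠ p → b p ≡ just c → b q ≡ just d → d ≤ c)
        × (∀ i → InC⁻ i → Odd i →
             (∀ p q → b p ≡ just i → b q ≡ just i → p ≡ q)
             × b Fin.zero ≢ just i)
        × Σ (ℕ → ℕ) λ ℓ → Σ (ℕ → List ℕ) λ W →
              (∀ i → Occurs i → IsColourWitnessOf i (ℓ i) (W i))
            × (∀ i j → j < i → Occurs i → Occurs j →
                 ∀ xs x y ys → W i ≡ xs ++ [ x ] → W j ≡ y ∷ ys → x < y)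
            × (∀ i → InC⁻ i → powSum i ≤ lenSum ℓ i)

open import Data.Fin using (_<?_; _≟_)
open import Relation.Nullary using (yes; no)

newWitness : ∀ {k} → (Fin (suc k) → Maybe ℕ) → Fin (suc k) → ℕ → (Fin (suc k) → Maybe ℕ)
newWitness b j d i with j <? i
... | yes _ = b i
... | no _ with i ≟ j
...   | no _ = nothing
...   | yes _ with j
...     | Fin.zero  = nothing
...     | Fin.suc _ = just d

module Submission where

-- Every colour of c other than d is an entry of b above d, and the new last
-- vertex has colour d, so the witnesses of b for those colours remain
-- witnesses in ρ'. A d-witness of length ℓ_e, for e = b_j, is obtained from
-- the e-witness by dropping its final odd position (when e is odd) and
-- appending m+1. The length condition of c at i is inherited from that of b at
-- a suitable colour: at i itself when i > d; at e when i = d, since P(d,c) is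
-- contained in P(e,b) and U(d,c) is U(e,b) with e traded for d; and at d+1
-- when j = 0. When j ≠ 0 and i < d the odd colour d, occurring in c, cuts off
-- every colour of c from U(i,c), so P(i,c) is empty.

open import Defs
open import Data.Nat using (ℕ; zero; suc; _+_; _^_; _≤_; _<_; _⊔_; _≤ᵇ_; _<ᵇ_; _≡ᵇ_; _%_; z≤n; s≤s)
open import Data.Nat.Properties
open import Data.Nat.Divisibility using (m%n≡0⇒n∣m; _∣?_)
open import Data.Nat.DivMod using (m%n<n; %-distribˡ-+)
open import Data.Nat.ListAction using (sum)
open import Data.Nat.ListAction.Properties using (sum-++)
open import Data.Fin using (Fin; toℕ) renaming (_<_ to _<ᶠ_)
import Data.Fin.Properties as Finₚ
open import Data.Bool using (Bool; true; false; _∧_; not; if_then_else_; T)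
open import Data.Bool.Properties using (T-≡; ¬-not; ∧-zeroʳ)
open import Data.Bool.ListAction using (any; all; and)
open import Data.Maybe using (Maybe; just; nothing)
open import Data.Maybe.Properties using (just-injective)
open import Data.List using (List; []; _∷_; _++_; [_]; _∷ʳ_; length; map; upTo; allFin; initLast; _∷ʳ′_)
open import Data.List.Properties using (upTo-∷ʳ; map-++; map-cong; length-++; ∷ʳ-injective; ++-assoc; ++-identityʳ)
open import Data.List.Membership.Propositional using (_∈_)
open import Data.List.Membership.Propositional.Properties using (∈-allFin; ∈-upTo⁺; ∈-upTo⁻)
open import Data.List.Relation.Unary.Any using (here; there; satisfied)
open import Data.List.Relation.Unary.Any.Properties using (any⁻)
open import Data.List.Relation.Unary.All as All using (All; []; _∷_)
open import Data.List.Relation.Unary.All.Properties using (++⁺; ++⁻ˡ; ++⁻ʳ)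
open import Data.List.Relation.Unary.Linked using (Linked; []; [-]; _∷_)
open import Data.Product as Product using (∃-syntax; _×_; _,_; proj₁; proj₂)
open import Data.Sum as Sum using (_⊎_; inj₁; inj₂)
open import Data.Empty using (⊥-elim)
open import Function using (_∘_; Equivalence)
open import Relation.Nullary using (¬_; yes; no; contradiction)
open import Relation.Binary using (tri<; tri≈; tri>)
open import Relation.Binary.PropositionalEquality hiding ([_])

T⇒≡true : ∀ {b} → T b → b ≡ true
T⇒≡true = Equivalence.to T-≡

≡true⇒T : ∀ {b} → b ≡ true → T b
≡true⇒T = Equivalence.from T-≡

≡-if-same-truth : ∀ {a b : Bool} → (a ≡ true → b ≡ true) → (b ≡ true → a ≡ true) → a ≡ b
≡-if-same-truth {false} {false} _ _ = refl
≡-if-same-truth {false} {true}  _ g = g refl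
≡-if-same-truth {true}          f _ = sym (f refl)

≤ᵇ-true : ∀ {i x} → i ≤ x → (i ≤ᵇ x) ≡ true
≤ᵇ-true = T⇒≡true ∘ ≤⇒≤ᵇ

≤ᵇ-false : ∀ {i x} → x < i → (i ≤ᵇ x) ≡ false
≤ᵇ-false {i} {x} x<i = ¬-not (<⇒≱ x<i ∘ ≤ᵇ⇒≤ i x ∘ ≡true⇒T)

<ᵇ-true : ∀ {i x} → i < x → (i <ᵇ x) ≡ true
<ᵇ-true = T⇒≡true ∘ <⇒<ᵇ

<ᵇ-false : ∀ {i x} → x ≤ i → (i <ᵇ x) ≡ false
<ᵇ-false {i} {x} x≤i = ¬-not (≤⇒≯ x≤i ∘ <ᵇ⇒< i x ∘ ≡true⇒T)

≡ᵇ-refl : ∀ x → (x ≡ᵇ x) ≡ true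
≡ᵇ-refl x = T⇒≡true (≡⇒≡ᵇ x x refl)

≡ᵇ-false : ∀ {x y} → x ≢ y → (x ≡ᵇ y) ≡ false
≡ᵇ-false {x} {y} x≢y = ¬-not (x≢y ∘ ≡ᵇ⇒≡ x y ∘ ≡true⇒T)

≤-suc-cases : ∀ {q m} → q ≤ suc m → q ≤ m ⊎ q ≡ suc m
≤-suc-cases q≤1+m = Sum.map₁ ≤-pred (m<1+n⇒m<n∨m≡n (s≤s q≤1+m))

odd⇒%2≡1 : ∀ {d} → Odd d → d % 2 ≡ 1
odd⇒%2≡1 {d} odd with d % 2 in eq | m%n<n d 2
... | 0           | _             = ⊥-elim (odd (m%n≡0⇒n∣m d 2 eq))
... | 1           | _             = refl
... | suc (suc _) | s≤s (s≤s ())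

odd⇒oddᵇ : ∀ {d} → Odd d → oddᵇ d ≡ true
odd⇒oddᵇ odd rewrite odd⇒%2≡1 odd = refl

odd⇒suc%2≡0 : ∀ {d} → Odd d → suc d % 2 ≡ 0
odd⇒suc%2≡0 {d} odd = trans (%-distribˡ-+ 1 d 2) (cong (λ r → (1 + r) % 2) (odd⇒%2≡1 odd))

odd⇒even-suc : ∀ {d} → Odd d → Even (suc d)
odd⇒even-suc {d} odd = m%n≡0⇒n∣m (suc d) 2 (odd⇒suc%2≡0 odd)

odd⇒¬oddᵇ-suc : ∀ {d} → Odd d → oddᵇ (suc d) ≡ false
odd⇒¬oddᵇ-suc odd rewrite odd⇒suc%2≡0 odd = refl

update : {A : Set} → ℕ → A → (ℕ → A) → ℕ → A
update a y f x = if x ≡ᵇ a then y else f x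

update-same : ∀ {A : Set} a (y : A) f → update a y f a ≡ y
update-same a y f rewrite ≡ᵇ-refl a = refl

update-other : ∀ {A : Set} {a x} (y : A) f → x ≢ a → update a y f x ≡ f x
update-other y f x≢a rewrite ≡ᵇ-false x≢a = refl

module _ {A : Set} where

  any-true : (f : A → Bool) (xs : List A) {x : A} → x ∈ xs → f x ≡ true → any f xs ≡ true
  any-true f (y ∷ xs) (here refl) fx rewrite fx = refl
  any-true f (y ∷ xs) (there x∈) fx with f y
  ... | true  = refl
  ... | false = any-true f xs x∈ fx

  all-true : (f : A → Bool) (xs : List A) → (∀ {x} → x ∈ xs → f x ≡ true) → all f xs ≡ true
  all-true f []       _ = refl
  all-true f (x ∷ xs) h rewrite h (here refl) = all-true f xs (h ∘ there)

  all-false : (f : A → Bool) (xs : List A) {x : A} → x ∈ xs → f x ≡ false → all f xs ≡ false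
  all-false f (y ∷ xs) (here refl) fx rewrite fx = refl
  all-false f (y ∷ xs) (there x∈) fx with f y
  ... | true  = all-false f xs x∈ fx
  ... | false = refl

  sum-map-mono : (f g : A → ℕ) (xs : List A) → (∀ x → f x ≤ g x) → sum (map f xs) ≤ sum (map g xs)
  sum-map-mono f g []       _ = z≤n
  sum-map-mono f g (x ∷ xs) h = +-mono-≤ (h x) (sum-map-mono f g xs h)

  sum-map-zero : (f : A → ℕ) (xs : List A) → (∀ x → f x ≡ 0) → sum (map f xs) ≡ 0
  sum-map-zero f []       _ = refl
  sum-map-zero f (x ∷ xs) h rewrite h x = sum-map-zero f xs h

  head-of-∷ʳ : ∀ (bs : List A) {ws zs z y ys} → ws ≡ bs ++ zs → bs ∷ʳ z ≡ y ∷ ys →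
               y ≡ z ⊎ ∃[ us ] ws ≡ y ∷ us
  head-of-∷ʳ []             _    refl = inj₁ refl
  head-of-∷ʳ (b ∷ bs) {zs = zs} refl refl = inj₂ (bs ++ zs , refl)

  module _ {R : A → A → Set} where

    linked-++ˡ : ∀ xs {ys} → Linked R (xs ++ ys) → Linked R xs
    linked-++ˡ []           _        = []
    linked-++ˡ (x ∷ [])     _        = [-]
    linked-++ˡ (x ∷ y ∷ xs) (r ∷ rs) = r ∷ linked-++ˡ (y ∷ xs) rs

    linked-middle : ∀ xs {y z zs} → Linked R (xs ++ y ∷ z ∷ zs) → R y z
    linked-middle []           (r ∷ _)  = r
    linked-middle (x ∷ [])     (_ ∷ rs) = linked-middle [] rs
    linked-middle (x ∷ y ∷ xs) (_ ∷ rs) = linked-middle (y ∷ xs) rs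

    linked-∷ʳ : ∀ xs {z} → Linked R xs → (∀ ys y → xs ≡ ys ∷ʳ y → R y z) → Linked R (xs ∷ʳ z)
    linked-∷ʳ []           _        _ = [-]
    linked-∷ʳ (x ∷ [])     _        h = h [] x refl ∷ [-]
    linked-∷ʳ (x ∷ y ∷ xs) (r ∷ rs) h = r ∷ linked-∷ʳ (y ∷ xs) rs (λ ys w eq → h (x ∷ ys) w (cong (x ∷_) eq))

  linked-map-All : ∀ {P : A → Set} {R S : A → A → Set} →
                   (∀ {x y} → P y → R x y → S x y) → ∀ {xs} → All P xs → Linked R xs → Linked S xs
  linked-map-All f _              []       = []
  linked-map-All f _              [-]      = [-]
  linked-map-All f (_ ∷ py ∷ ps)  (r ∷ rs) = f py r ∷ linked-map-All f (py ∷ ps) rs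

sumUpTo : (ℕ → ℕ) → ℕ → ℕ
sumUpTo h n = sum (map h (upTo n))

sumUpTo-suc : ∀ h n → sumUpTo h (suc n) ≡ sumUpTo h n + h n
sumUpTo-suc h n = begin
  sum (map h (upTo (suc n)))       ≡⟨ cong (sum ∘ map h) (sym (upTo-∷ʳ n)) ⟩
  sum (map h (upTo n ++ [ n ]))    ≡⟨ cong sum (map-++ h (upTo n) [ n ]) ⟩
  sum (map h (upTo n) ++ [ h n ])  ≡⟨ sum-++ (map h (upTo n)) [ h n ] ⟩
  sumUpTo h n + (h n + 0)          ≡⟨ cong (sumUpTo h n +_) (+-identityʳ (h n)) ⟩
  sumUpTo h n + h n                ∎
  where open ≡-Reasoning

sumUpTo-cong : ∀ f g n → (∀ {x} → x < n → f x ≡ g x) → sumUpTo f n ≡ sumUpTo g n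
sumUpTo-cong f g zero    _ = refl
sumUpTo-cong f g (suc n) h = begin
  sumUpTo f (suc n)  ≡⟨ sumUpTo-suc f n ⟩
  sumUpTo f n + f n  ≡⟨ cong₂ _+_ (sumUpTo-cong f g n (h ∘ m<n⇒m<1+n)) (h ≤-refl) ⟩
  sumUpTo g n + g n  ≡⟨ sym (sumUpTo-suc g n) ⟩
  sumUpTo g (suc n)  ∎
  where open ≡-Reasoning

sumUpTo-extract : ∀ h a n → a < n → sumUpTo h n ≡ h a + sumUpTo (update a 0 h) n
sumUpTo-extract h a (suc n) a<1+n with a ≟ n
... | yes refl = begin
  sumUpTo h (suc a)               ≡⟨ sumUpTo-suc h a ⟩
  sumUpTo h a + h a               ≡⟨ +-comm _ (h a) ⟩
  h a + sumUpTo h a               ≡⟨ cong (h a +_) (sumUpTo-cong h h' a (λ x<a → sym (update-other 0 h (<⇒≢ x<a)))) ⟩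
  h a + sumUpTo h' a              ≡⟨ cong (h a +_) (sym (+-identityʳ _)) ⟩
  h a + (sumUpTo h' a + 0)        ≡⟨ cong (λ t → h a + (sumUpTo h' a + t)) (sym (update-same a 0 h)) ⟩
  h a + (sumUpTo h' a + h' a)     ≡⟨ cong (h a +_) (sym (sumUpTo-suc h' a)) ⟩
  h a + sumUpTo h' (suc a)        ∎
  where
  open ≡-Reasoning
  h' : ℕ → ℕ
  h' = update a 0 h
... | no a≢n = begin
  sumUpTo h (suc n)               ≡⟨ sumUpTo-suc h n ⟩
  sumUpTo h n + h n               ≡⟨ cong (_+ h n) (sumUpTo-extract h a n (≤∧≢⇒< (≤-pred a<1+n) a≢n)) ⟩
  h a + sumUpTo h' n + h n        ≡⟨ +-assoc (h a) _ _ ⟩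
  h a + (sumUpTo h' n + h n)      ≡⟨ cong (λ t → h a + (sumUpTo h' n + t)) (sym (update-other 0 h (a≢n ∘ sym))) ⟩
  h a + (sumUpTo h' n + h' n)     ≡⟨ cong (h a +_) (sym (sumUpTo-suc h' n)) ⟩
  h a + sumUpTo h' (suc n)        ∎
  where
  open ≡-Reasoning
  h' : ℕ → ℕ
  h' = update a 0 h

sumUpTo-≤-matching : ∀ f g {a a' n} → a < n → a' < n → f a ≤ g a' →
                     (∀ x → update a 0 f x ≤ update a' 0 g x) → sumUpTo f n ≤ sumUpTo g n
sumUpTo-≤-matching f g {a} {a'} {n} a<n a'<n fa≤ga' rest = begin
  sumUpTo f n                        ≡⟨ sumUpTo-extract f a n a<n ⟩
  f a + sumUpTo (update a 0 f) n     ≤⟨ +-mono-≤ fa≤ga' (sum-map-mono _ _ (upTo n) rest) ⟩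
  g a' + sumUpTo (update a' 0 g) n   ≡⟨ sym (sumUpTo-extract g a' n a'<n) ⟩
  sumUpTo g n                        ∎
  where open ≤-Reasoning

module ColourSums (G : ParityGame) (m : ℕ) (ρ : ℕ → V G) (k : ℕ) (X : Fin (suc k) → Maybe ℕ) where

  Occ : ℕ → Set
  Occ = Occurs G m ρ k X

  occ : ℕ → Bool
  occ = occursᵇ G m ρ k X

  inU : ℕ → ℕ → Bool
  inU = inUᵇ G m ρ k X

  -- inU i x decides x ∈ U(i,X), and blocks i y holds when y is an odd colour
  -- of X above i, i.e. when it bounds odd(i,X) from above.
  blocks : ℕ → ℕ → Bool
  blocks i y = (i <ᵇ y) ∧ oddᵇ y ∧ occ y

  lenTerm : (ℕ → ℕ) → ℕ → ℕ → ℕ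
  lenTerm ℓ i x = if inU i x then ℓ x else 0

  InP : ℕ → Fin (suc k) → Set
  InP i p = ∃[ x ] (X p ≡ just x × inU i x ≡ true)

  pow : ℕ → ℕ
  pow = powSum G m ρ k X

  len : (ℕ → ℕ) → ℕ → ℕ
  len = lenSum G m ρ k X

  occ-true : ∀ {y} → Occ y → occ y ≡ true
  occ-true {y} (p , Xp≡y) =
    any-true _ (allFin (suc k)) (∈-allFin p) (subst (λ t → isᵇ G m ρ k X t y ≡ true) (sym Xp≡y) (≡ᵇ-refl y))

  occ⇒Occ : ∀ {y} → occ y ≡ true → Occ y
  occ⇒Occ {y} o = Product.map₂ (isᵇ-just (X _)) (satisfied (any⁻ _ (allFin (suc k)) (≡true⇒T o)))
    where
    isᵇ-just : ∀ mx → T (isᵇ G m ρ k X mx y) → mx ≡ just y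
    isᵇ-just (just x) t = cong just (≡ᵇ⇒≡ x y t)

  occ-false : ∀ {y} → ¬ Occ y → occ y ≡ false
  occ-false ¬occ = ¬-not (¬occ ∘ occ⇒Occ)

  inU-unoccurring : ∀ {i x} → occ x ≡ false → inU i x ≡ false
  inU-unoccurring o rewrite o = refl

  inU-below : ∀ {i x} → x < i → inU i x ≡ false
  inU-below {i} {x} x<i with occ x
  ... | false = refl
  ... | true  rewrite ≤ᵇ-false x<i = refl

  inU⇒≤ : ∀ {i x} → inU i x ≡ true → i ≤ x
  inU⇒≤ {i} {x} u with x <? i
  ... | yes x<i = contradiction (trans (sym (inU-below x<i)) u) λ ()
  ... | no  x≮i = ≮⇒≥ x≮i

  blocks-≤ : ∀ {i y} → y ≤ i → blocks i y ≡ false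
  blocks-≤ y≤i rewrite <ᵇ-false y≤i = refl

  blocks-> : ∀ {i y} → i < y → blocks i y ≡ (oddᵇ y ∧ occ y)
  blocks-> i<y rewrite <ᵇ-true i<y = refl

  blocks-unoccurring : ∀ {i y} → occ y ≡ false → blocks i y ≡ false
  blocks-unoccurring {i} {y} o rewrite o | ∧-zeroʳ (oddᵇ y) = ∧-zeroʳ (i <ᵇ y)

  blocks-even : ∀ {i y} → oddᵇ y ≡ false → blocks i y ≡ false
  blocks-even {i} {y} o rewrite o = ∧-zeroʳ (i <ᵇ y)

  inU-refl : ∀ {i} → occ i ≡ true → inU i i ≡ true
  inU-refl {i} o = cong₂ _∧_ o (cong₂ _∧_ (≤ᵇ-true {i} ≤-refl)
    (all-true (not ∘ blocks i) (upTo (suc i)) (λ y∈ → cong not (blocks-≤ (≤-pred (∈-upTo⁻ y∈))))))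

  inU-blocked : ∀ {i y x} → i < y → y ≤ x → oddᵇ y ≡ true → occ y ≡ true → inU i x ≡ false
  inU-blocked {i} {y} {x} i<y y≤x odd o with occ x | i ≤ᵇ x
  ... | false | _     = refl
  ... | true  | false = refl
  ... | true  | true  =
    all-false (not ∘ blocks i) (upTo (suc x)) (∈-upTo⁺ (s≤s y≤x)) (cong not (trans (blocks-> i<y) (cong₂ _∧_ odd o)))

  lenTerm-∈ : ∀ ℓ {i x} → inU i x ≡ true → lenTerm ℓ i x ≡ ℓ x
  lenTerm-∈ ℓ u rewrite u = refl

  lenTerm-∉ : ∀ ℓ {i x} → inU i x ≡ false → lenTerm ℓ i x ≡ 0
  lenTerm-∉ ℓ u rewrite u = refl

  posTerm-InP : ∀ {i p} → InP i p → posTerm G m ρ k X i p ≡ 2 ^ toℕ p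
  posTerm-InP {i} {p} (x , Xp≡x , u) rewrite Xp≡x | u = refl

  posTerm-cases : ∀ i p → posTerm G m ρ k X i p ≡ 0 ⊎ InP i p
  posTerm-cases i p with X p
  ... | nothing = inj₁ refl
  ... | just x with inU i x in u
  ...   | true  = inj₂ (x , refl , u)
  ...   | false = inj₁ refl

  powSum-zero : ∀ {i} → (∀ p → ¬ InP i p) → pow i ≡ 0
  powSum-zero {i} none = sum-map-zero _ (allFin (suc k)) zero-at
    where
    zero-at : ∀ p → posTerm G m ρ k X i p ≡ 0
    zero-at p with posTerm-cases i p
    ... | inj₁ z   = z
    ... | inj₂ inP = ⊥-elim (none p inP)

module Comparison (G : ParityGame) (m : ℕ) (ρ : ℕ → V G) (m' : ℕ) (ρ' : ℕ → V G)
                  (k : ℕ) (X Y : Fin (suc k) → Maybe ℕ) where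
  open ParityGame G using (maxC)
  module OfX = ColourSums G m ρ k X
  module OfY = ColourSums G m' ρ' k Y

  occ-cong : ∀ {y} → (OfX.Occ y → OfY.Occ y) → (OfY.Occ y → OfX.Occ y) → OfX.occ y ≡ OfY.occ y
  occ-cong to from = ≡-if-same-truth (OfY.occ-true ∘ to ∘ OfX.occ⇒Occ) (OfX.occ-true ∘ from ∘ OfY.occ⇒Occ)

  inU-cong : ∀ {i i' x} → OfX.occ x ≡ OfY.occ x → (i ≤ᵇ x) ≡ (i' ≤ᵇ x) →
             (∀ y → OfX.blocks i y ≡ OfY.blocks i' y) → OfX.inU i x ≡ OfY.inU i' x
  inU-cong {x = x} o l bl = cong₂ _∧_ o (cong₂ _∧_ l (cong and (map-cong (cong not ∘ bl) (upTo (suc x)))))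

  powSum-mono : ∀ {i i'} → (∀ p → OfX.InP i p → OfY.InP i' p) → OfX.pow i ≤ OfY.pow i'
  powSum-mono {i} {i'} P⊆P = sum-map-mono _ _ (allFin (suc k)) term-≤
    where
    term-≤ : ∀ p → posTerm G m ρ k X i p ≤ posTerm G m' ρ' k Y i' p
    term-≤ p with OfX.posTerm-cases i p
    ... | inj₁ z   rewrite z = z≤n
    ... | inj₂ inP = ≤-reflexive (trans (OfX.posTerm-InP inP) (sym (OfY.posTerm-InP (P⊆P p inP))))

  lenSum-mono : ∀ ℓ ℓ' {i i'} → (∀ x → OfX.inU i x ≡ true → OfY.inU i' x ≡ true × ℓ x ≤ ℓ' x) →
                OfX.len ℓ i ≤ OfY.len ℓ' i'
  lenSum-mono ℓ ℓ' {i} {i'} U⊆U = sum-map-mono _ _ (upTo (suc maxC)) term-≤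
    where
    term-≤ : ∀ x → OfX.lenTerm ℓ i x ≤ OfY.lenTerm ℓ' i' x
    term-≤ x with OfX.inU i x in u
    ... | false = z≤n
    ... | true  with U⊆U x u
    ...   | u' , ℓx≤ rewrite u' = ℓx≤

module Extension (G : ParityGame) (m : ℕ) (ρ : ℕ → V G) (v : V G) where
  open ParityGame G

  ρ' : ℕ → V G
  ρ' = extend G ρ m v

  InRange : ℕ → ℕ → Set
  InRange n p = 1 ≤ p × p ≤ n

  col-old : ∀ {q} → q ≤ m → col G (suc m) ρ' q ≡ col G m ρ q
  col-old {q} q≤m = cong (λ t → φ (if t then ρ q else v)) (≤ᵇ-true q≤m)

  col-new : col G (suc m) ρ' (suc m) ≡ φ v
  col-new = cong (λ t → φ (if t then ρ (suc m) else v)) (≤ᵇ-false (n<1+n m))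

  inRange-extend : ∀ {p} → InRange m p → InRange (suc m) p
  inRange-extend (1≤p , p≤m) = 1≤p , m≤n⇒m≤1+n p≤m

  step-extend : ∀ {p p'} → p' ≤ m → Step G m ρ p p' → Step G (suc m) ρ' p p'
  step-extend {p} {p'} p'≤m (p<p' , dominated) = p<p' , dominated'
    where
    p≤m : p ≤ m
    p≤m = <⇒≤ (<-≤-trans p<p' p'≤m)
    dominated' : ∀ q → p ≤ q → q ≤ p' → col G (suc m) ρ' q ≤ col G (suc m) ρ' p ⊔ col G (suc m) ρ' p'
    dominated' q p≤q q≤p' = begin
      col G (suc m) ρ' q                        ≡⟨ col-old (≤-trans q≤p' p'≤m) ⟩
      col G m ρ q                               ≤⟨ dominated q p≤q q≤p' ⟩
      col G m ρ p ⊔ col G m ρ p'                ≡⟨ sym (cong₂ _⊔_ (col-old p≤m) (col-old p'≤m)) ⟩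
      col G (suc m) ρ' p ⊔ col G (suc m) ρ' p'  ∎
      where open ≤-Reasoning

  chain-extend : ∀ {ps} → All (InRange m) ps → Linked (Step G m ρ) ps → Linked (Step G (suc m) ρ') ps
  chain-extend = linked-map-All (step-extend ∘ proj₂)

  evens-extend : ∀ {ps} → All (InRange m) ps → All (Even ∘ col G m ρ) ps → All (Even ∘ col G (suc m) ρ') ps
  evens-extend inRange evens =
    All.zipWith (λ ((_ , p≤m) , even) → subst Even (sym (col-old p≤m)) even) (inRange , evens)

  witnessOf-extend : ∀ {i ℓ ps} → φ v ≤ i → IsColourWitnessOf G m ρ i ℓ ps → IsColourWitnessOf G (suc m) ρ' i ℓ ps
  witnessOf-extend {i} {ps = ps} d≤i (even-length , odd-length , inRange , chain , last) =
    even-length , odd-length , All.map inRange-extend inRange , chain-extend inRange chain , last'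
    where
    last' : ∀ xs x → ps ≡ xs ++ [ x ] →
            All (Even ∘ col G (suc m) ρ') xs × col G (suc m) ρ' x ≡ i × (∀ q → x ≤ q → q ≤ suc m → col G (suc m) ρ' q ≤ i)
    last' xs x refl with last xs x refl | ++⁻ʳ xs inRange
    ... | evens , col-x , outer | (_ , x≤m) ∷ [] =
      evens-extend (++⁻ˡ xs inRange) evens , trans (col-old x≤m) col-x , outer'
      where
      outer' : ∀ q → x ≤ q → q ≤ suc m → col G (suc m) ρ' q ≤ i
      outer' q x≤q q≤1+m with ≤-suc-cases q≤1+m
      ... | inj₁ q≤m  = subst (_≤ i) (sym (col-old q≤m)) (outer q x≤q q≤m)
      ... | inj₂ refl = subst (_≤ i) (sym col-new) d≤i

  step-to-new : ∀ {y} → y ≤ m → (∀ q → y ≤ q → q ≤ m → col G m ρ q ≤ col G m ρ y ⊔ φ v) →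
                Step G (suc m) ρ' y (suc m)
  step-to-new {y} y≤m dominated = s≤s y≤m , dominated'
    where
    dominated' : ∀ q → y ≤ q → q ≤ suc m → col G (suc m) ρ' q ≤ col G (suc m) ρ' y ⊔ col G (suc m) ρ' (suc m)
    dominated' q y≤q q≤1+m with ≤-suc-cases q≤1+m
    ... | inj₂ refl = m≤n⊔m _ _
    ... | inj₁ q≤m  = begin
      col G (suc m) ρ' q                             ≡⟨ col-old q≤m ⟩
      col G m ρ q                                    ≤⟨ dominated q y≤q q≤m ⟩
      col G m ρ y ⊔ φ v                              ≡⟨ sym (cong₂ _⊔_ (col-old y≤m) col-new) ⟩
      col G (suc m) ρ' y ⊔ col G (suc m) ρ' (suc m)  ∎
      where open ≤-Reasoning

  -- The even-coloured part of an e-colour witness ws (all of it when e is even,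
  -- all but its last position when e is odd); appending m+1 to it yields a
  -- d-colour witness in ρ' of the same length.
  record EvenPrefix (d ℓ : ℕ) (ws bs : List ℕ) : Set where
    field
      length≡       : length bs ≡ ℓ
      inRange       : All (InRange m) bs
      chain         : Linked (Step G m ρ) bs
      evens         : All (Even ∘ col G m ρ) bs
      lastDominates : ∀ ys y → bs ≡ ys ∷ʳ y → ∀ q → y ≤ q → q ≤ m → col G m ρ q ≤ col G m ρ y ⊔ d
      prefix        : ∃[ zs ] ws ≡ bs ++ zs

  evens-of-even : ∀ {e ℓ ws} → Even e → IsColourWitnessOf G m ρ e ℓ ws → All (Even ∘ col G m ρ) ws
  evens-of-even {ws = ws} even (_ , _ , _ , _ , last) with initLast ws
  ... | []       = []
  ... | xs ∷ʳ′ x = let (evens , col-x , _) = last xs x refl in ++⁺ evens (subst Even (sym col-x) even ∷ [])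

  evenPrefix-even : ∀ {e d ℓ ws} → Even e → e ≤ d → IsColourWitnessOf G m ρ e ℓ ws → EvenPrefix d ℓ ws ws
  evenPrefix-even {d = d} {ws = ws} even e≤d w@(even-length , _ , inRange , chain , last) = record
    { length≡ = even-length even ; inRange = inRange ; chain = chain ; evens = evens-of-even even w
    ; lastDominates = λ ys y eq q y≤q q≤m →
        ≤-trans (proj₂ (proj₂ (last ys y eq)) q y≤q q≤m) (≤-trans e≤d (m≤n⊔m _ d))
    ; prefix = [] , sym (++-identityʳ ws) }

  evenPrefix-odd : ∀ {e d ℓ xs x} → Odd e → e ≤ d → IsColourWitnessOf G m ρ e ℓ (xs ∷ʳ x) →
                   EvenPrefix d ℓ (xs ∷ʳ x) xs
  evenPrefix-odd {e} {d} {xs = xs} {x} odd e≤d (_ , odd-length , inRange , chain , last) = record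
    { length≡ = suc-injective (trans (trans (+-comm 1 (length xs)) (sym (length-++ xs))) (odd-length odd))
    ; inRange = ++⁻ˡ xs inRange ; chain = linked-++ˡ xs chain ; evens = evens
    ; lastDominates = dominated ; prefix = [ x ] , refl }
    where
    evens : All (Even ∘ col G m ρ) xs
    evens = proj₁ (last xs x refl)
    col-x : col G m ρ x ≡ e
    col-x = proj₁ (proj₂ (last xs x refl))
    outer : ∀ q → x ≤ q → q ≤ m → col G m ρ q ≤ e
    outer = proj₂ (proj₂ (last xs x refl))
    dominated : ∀ ys y → xs ≡ ys ∷ʳ y → ∀ q → y ≤ q → q ≤ m → col G m ρ q ≤ col G m ρ y ⊔ d
    dominated ys y refl q y≤q q≤m with q ≤? x
    ... | yes q≤x = ≤-trans (proj₂ step q y≤q q≤x) (⊔-monoʳ-≤ (col G m ρ y) (≤-trans (≤-reflexive col-x) e≤d))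
      where
      step : Step G m ρ y x
      step = linked-middle ys (subst (Linked (Step G m ρ)) (++-assoc ys [ y ] [ x ]) chain)
    ... | no q≰x = ≤-trans (outer q (<⇒≤ (≰⇒> q≰x)) q≤m) (≤-trans e≤d (m≤n⊔m (col G m ρ y) d))

  evenPrefix : ∀ {e d ℓ ws} → e ≤ d → IsColourWitnessOf G m ρ e ℓ ws → ∃[ bs ] EvenPrefix d ℓ ws bs
  evenPrefix {e} {ws = ws} e≤d w with 2 ∣? e | initLast ws
  ... | yes even | _        = ws , evenPrefix-even even e≤d w
  ... | no odd   | []       = ⊥-elim (0≢1+n (proj₁ (proj₂ w) odd))
  ... | no odd   | xs ∷ʳ′ x = xs , evenPrefix-odd odd e≤d w

  witnessOf-close : ∀ {e ℓ ws} → Odd (φ v) → e ≤ φ v → IsColourWitnessOf G m ρ e ℓ ws →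
                    ∃[ ps ] IsColourWitnessOf G (suc m) ρ' (φ v) ℓ ps
                          × (∀ y ys → ps ≡ y ∷ ys → y ≡ suc m ⊎ ∃[ zs ] ws ≡ y ∷ zs)
  witnessOf-close {ℓ = ℓ} odd e≤d w with evenPrefix e≤d w
  ... | bs , p = bs ∷ʳ suc m , closed , λ y ys → head-of-∷ʳ bs (proj₂ prefix)
    where
    open EvenPrefix p
    last-step : ∀ ys y → bs ≡ ys ∷ʳ y → Step G (suc m) ρ' y (suc m)
    last-step ys y refl = step-to-new (proj₂ (All.head (++⁻ʳ ys inRange))) (lastDominates ys y refl)
    last : ∀ xs x → bs ≡ xs × suc m ≡ x →
           All (Even ∘ col G (suc m) ρ') xs × col G (suc m) ρ' x ≡ φ v
           × (∀ q → x ≤ q → q ≤ suc m → col G (suc m) ρ' q ≤ φ v)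
    last _ _ (refl , refl) = evens-extend inRange evens , col-new
      , λ q x≤q q≤x → ≤-reflexive (trans (cong (col G (suc m) ρ') (≤-antisym q≤x x≤q)) col-new)
    closed : IsColourWitnessOf G (suc m) ρ' (φ v) ℓ (bs ∷ʳ suc m)
    closed = (λ even → ⊥-elim (odd even))
           , (λ _ → trans (length-++ bs) (trans (+-comm _ 1) (cong suc length≡)))
           , ++⁺ (All.map inRange-extend inRange) ((s≤s z≤n , ≤-refl) ∷ [])
           , linked-∷ʳ bs (chain-extend inRange chain) last-step
           , λ xs x eq → last xs x (∷ʳ-injective bs xs eq)

module _ {k : ℕ} (b : Fin (suc k) → Maybe ℕ) (d : ℕ) where

  newWitness-above : ∀ {j p} → j <ᶠ p → newWitness b j d p ≡ b p
  newWitness-above {j} {p} j<p with j Finₚ.<? p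
  ... | yes _   = refl
  ... | no j≮p = ⊥-elim (j≮p j<p)

  newWitness-below : ∀ {j p} → p <ᶠ j → newWitness b j d p ≡ nothing
  newWitness-below {j} {p} p<j with j Finₚ.<? p
  ... | yes j<p = ⊥-elim (<-asym p<j j<p)
  ... | no _ with p Finₚ.≟ j
  ...   | no _     = refl
  ...   | yes refl = ⊥-elim (<-irrefl refl p<j)

  newWitness-at : ∀ j → (j ≡ Fin.zero × newWitness b j d j ≡ nothing) ⊎ (j ≢ Fin.zero × newWitness b j d j ≡ just d)
  newWitness-at Fin.zero    = inj₁ (refl , refl)
  newWitness-at (Fin.suc j) with Fin.suc j Finₚ.<? Fin.suc j
  ... | yes j<j = ⊥-elim (<-irrefl refl j<j)
  ... | no _ with Fin.suc j Finₚ.≟ Fin.suc j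
  ...   | no j≢j = ⊥-elim (j≢j refl)
  ...   | yes _  = inj₂ ((λ ()) , refl)

module NewWitness (G : ParityGame) (m : ℕ) (ρ : ℕ → V G) (v : V G)
  (d∈C⁻ : InC⁻ G (ParityGame.φ G v)) (d-odd : Odd (ParityGame.φ G v))
  (k : ℕ) (b : Fin (suc k) → Maybe ℕ)
  (order : ∀ p q x y → q <ᶠ p → b p ≡ just x → b q ≡ just y → y ≤ x)
  (j : Fin (suc k)) (e : ℕ) (bj≡e : b j ≡ just e) (e≤d : e ≤ ParityGame.φ G v)
  (above : ∀ p → j <ᶠ p → b p ≡ nothing ⊎ ∃[ x ] (b p ≡ just x × ParityGame.φ G v < x))
  where
  open ParityGame G
  open Extension G m ρ v

  d : ℕ
  d = φ v

  c : Fin (suc k) → Maybe ℕ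
  c = newWitness b j d

  module B  = ColourSums G m ρ k b
  module C  = ColourSums G (suc m) ρ' k c
  module CB = Comparison G (suc m) ρ' m ρ k c b
  module BC = Comparison G m ρ (suc m) ρ' k b c

  b-above : ∀ {p x} → j <ᶠ p → b p ≡ just x → d < x
  b-above {p} j<p bp≡x with above p j<p
  ... | inj₁ bp≡nothing = contradiction (trans (sym bp≡x) bp≡nothing) λ ()
  ... | inj₂ (_ , bp≡x' , d<x') rewrite just-injective (trans (sym bp≡x) bp≡x') = d<x'

  b-not-above : ∀ {p x} → ¬ j <ᶠ p → b p ≡ just x → x ≤ e
  b-not-above {p} j≮p bp≡x with Finₚ.<-cmp j p
  ... | tri< j<p _ _  = ⊥-elim (j≮p j<p)
  ... | tri≈ _ refl _ = ≤-reflexive (just-injective (trans (sym bp≡x) bj≡e))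
  ... | tri> _ _ p<j  = order j p e _ p<j bj≡e bp≡x

  c-just : ∀ p {x} → c p ≡ just x → (x ≡ d × p ≡ j × j ≢ Fin.zero) ⊎ (j <ᶠ p × b p ≡ just x × d < x)
  c-just p {x} cp≡x with Finₚ.<-cmp j p
  ... | tri< j<p _ _ = inj₂ (j<p , bp≡x , b-above j<p bp≡x)
    where
    bp≡x : b p ≡ just x
    bp≡x = trans (sym (newWitness-above b d j<p)) cp≡x
  ... | tri> _ _ p<j = contradiction (trans (sym cp≡x) (newWitness-below b d p<j)) λ ()
  ... | tri≈ _ refl _ with newWitness-at b d j
  ...   | inj₁ (_ , cj≡nothing) = contradiction (trans (sym cp≡x) cj≡nothing) λ ()
  ...   | inj₂ (j≢0 , cj≡d)     = inj₁ (just-injective (trans (sym cp≡x) cj≡d) , refl , j≢0)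

  c-occurs : ∀ {x} → C.Occ x → (x ≡ d × j ≢ Fin.zero) ⊎ (d < x × B.Occ x)
  c-occurs (p , cp≡x) with c-just p cp≡x
  ... | inj₁ (x≡d , _ , j≢0)  = inj₁ (x≡d , j≢0)
  ... | inj₂ (_ , bp≡x , d<x) = inj₂ (d<x , p , bp≡x)

  c-occurs⇒d≤ : ∀ {x} → C.Occ x → d ≤ x
  c-occurs⇒d≤ o with c-occurs o
  ... | inj₁ (refl , _) = ≤-refl
  ... | inj₂ (d<x , _)  = <⇒≤ d<x

  occ-above : ∀ {y} → d < y → C.occ y ≡ B.occ y
  occ-above {y} d<y = CB.occ-cong to from
    where
    to : C.Occ y → B.Occ y
    to o with c-occurs o
    ... | inj₁ (refl , _) = ⊥-elim (<-irrefl refl d<y)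
    ... | inj₂ (_ , o')   = o'
    from : B.Occ y → C.Occ y
    from (p , bp≡y) with j Finₚ.<? p
    ... | yes j<p = p , trans (newWitness-above b d j<p) bp≡y
    ... | no j≮p  = ⊥-elim (<⇒≱ d<y (≤-trans (b-not-above j≮p bp≡y) e≤d))

  occ-b-between : ∀ {y} → e < y → y ≤ d → B.occ y ≡ false
  occ-b-between {y} e<y y≤d = B.occ-false not-occurring
    where
    not-occurring : ¬ B.Occ y
    not-occurring (p , bp≡y) with j Finₚ.<? p
    ... | yes j<p = <⇒≱ (b-above j<p bp≡y) y≤d
    ... | no j≮p  = <⇒≱ e<y (b-not-above j≮p bp≡y)

  occ-c-d : j ≢ Fin.zero → C.occ d ≡ true
  occ-c-d j≢0 with newWitness-at b d j
  ... | inj₁ (j≡0 , _) = ⊥-elim (j≢0 j≡0)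
  ... | inj₂ (_ , cj≡d) = C.occ-true (j , cj≡d)

  occ-c-≤d : j ≡ Fin.zero → ∀ {y} → y ≤ d → C.occ y ≡ false
  occ-c-≤d j≡0 y≤d = C.occ-false not-occurring
    where
    not-occurring : ¬ C.Occ _
    not-occurring o with c-occurs o
    ... | inj₁ (_ , j≢0) = j≢0 j≡0
    ... | inj₂ (d<y , _) = <⇒≱ d<y y≤d

  inU-above : ∀ {i} x → d < i → C.inU i x ≡ B.inU i x
  inU-above {i} x d<i with x <? i
  ... | yes x<i = trans (C.inU-below x<i) (sym (B.inU-below x<i))
  ... | no x≮i  = CB.inU-cong (occ-above (<-≤-trans d<i (≮⇒≥ x≮i))) refl agree
    where
    agree : ∀ y → C.blocks i y ≡ B.blocks i y
    agree y with y ≤? i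
    ... | yes y≤i = trans (C.blocks-≤ y≤i) (sym (B.blocks-≤ y≤i))
    ... | no y≰i  = begin
      C.blocks i y      ≡⟨ C.blocks-> i<y ⟩
      oddᵇ y ∧ C.occ y  ≡⟨ cong (oddᵇ y ∧_) (occ-above (<-trans d<i i<y)) ⟩
      oddᵇ y ∧ B.occ y  ≡⟨ sym (B.blocks-> i<y) ⟩
      B.blocks i y      ∎
      where
      open ≡-Reasoning
      i<y : i < y
      i<y = ≰⇒> y≰i

  inU-d : ∀ {x} → d < x → C.inU d x ≡ B.inU e x
  inU-d {x} d<x = CB.inU-cong (occ-above d<x)
    (trans (≤ᵇ-true (<⇒≤ d<x)) (sym (≤ᵇ-true (≤-trans e≤d (<⇒≤ d<x))))) agree
    where
    agree : ∀ y → C.blocks d y ≡ B.blocks e y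
    agree y with y ≤? e | y ≤? d
    ... | yes y≤e | _       = trans (C.blocks-≤ (≤-trans y≤e e≤d)) (sym (B.blocks-≤ y≤e))
    ... | no y≰e  | yes y≤d = trans (C.blocks-≤ y≤d) (sym (B.blocks-unoccurring (occ-b-between (≰⇒> y≰e) y≤d)))
    ... | no y≰e  | no y≰d  = begin
      C.blocks d y      ≡⟨ C.blocks-> (≰⇒> y≰d) ⟩
      oddᵇ y ∧ C.occ y  ≡⟨ cong (oddᵇ y ∧_) (occ-above (≰⇒> y≰d)) ⟩
      oddᵇ y ∧ B.occ y  ≡⟨ sym (B.blocks-> (≰⇒> y≰e)) ⟩
      B.blocks e y      ∎
      where open ≡-Reasoning

  inU-j≡0 : j ≡ Fin.zero → ∀ {i} → i ≤ d → ∀ x → C.inU i x ≡ B.inU (suc d) x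
  inU-j≡0 j≡0 {i} i≤d x with x ≤? d
  ... | yes x≤d = trans (C.inU-unoccurring (occ-c-≤d j≡0 x≤d)) (sym (B.inU-below (s≤s x≤d)))
  ... | no x≰d  = CB.inU-cong (occ-above d<x) (trans (≤ᵇ-true (≤-trans i≤d (<⇒≤ d<x))) (sym (≤ᵇ-true d<x))) agree
    where
    d<x : d < x
    d<x = ≰⇒> x≰d
    agree : ∀ y → C.blocks i y ≡ B.blocks (suc d) y
    agree y with y ≤? d | y ≟ suc d
    ... | yes y≤d | _        = trans (C.blocks-unoccurring (occ-c-≤d j≡0 y≤d)) (sym (B.blocks-≤ (m≤n⇒m≤1+n y≤d)))
    ... | no _    | yes refl = trans (C.blocks-even {i} {suc d} (odd⇒¬oddᵇ-suc d-odd)) (sym (B.blocks-≤ {suc d} ≤-refl))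
    ... | no y≰d  | no y≢1+d = begin
      C.blocks i y      ≡⟨ C.blocks-> (≤-<-trans i≤d (≰⇒> y≰d)) ⟩
      oddᵇ y ∧ C.occ y  ≡⟨ cong (oddᵇ y ∧_) (occ-above (≰⇒> y≰d)) ⟩
      oddᵇ y ∧ B.occ y  ≡⟨ sym (B.blocks-> (≤∧≢⇒< (≰⇒> y≰d) (y≢1+d ∘ sym))) ⟩
      B.blocks (suc d) y ∎
      where open ≡-Reasoning

  inU-j≢0 : j ≢ Fin.zero → ∀ {i x} → i < d → d ≤ x → C.inU i x ≡ false
  inU-j≢0 j≢0 i<d d≤x = C.inU-blocked i<d d≤x (odd⇒oddᵇ d-odd) (occ-c-d j≢0)

  d<maxC : d < maxC
  d<maxC = ≤∧≢⇒< (proj₂ (proj₁ d∈C⁻)) (λ d≡max → proj₂ d∈C⁻ (d≡max , subst Odd d≡max d-odd))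

  suc-d∈C⁻ : InC⁻ G (suc d)
  suc-d∈C⁻ = (≤-trans (proj₁ (proj₁ d∈C⁻)) (n≤1+n d) , d<maxC)
           , λ (1+d≡max , odd-max) → odd-max (subst Even 1+d≡max (odd⇒even-suc d-odd))

  entries-c : (∀ p x → b p ≡ just x → InC⁻ G x) → ∀ p x → c p ≡ just x → InC⁻ G x
  entries-c entries p x cp≡x with c-just p cp≡x
  ... | inj₁ (refl , _)       = d∈C⁻
  ... | inj₂ (_ , bp≡x , _)   = entries p x bp≡x

  order-c : ∀ p q x y → q <ᶠ p → c p ≡ just x → c q ≡ just y → y ≤ x
  order-c p q x y q<p cp≡x cq≡y with c-just q cq≡y
  ... | inj₁ (refl , _) = c-occurs⇒d≤ (p , cp≡x)
  ... | inj₂ (j<q , bq≡y , _) with c-just p cp≡x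
  ...   | inj₁ (_ , refl , _)   = ⊥-elim (<-asym j<q q<p)
  ...   | inj₂ (_ , bp≡x , _)   = order p q x y q<p bp≡x bq≡y

  concise-c : (∀ i → InC⁻ G i → Odd i → (∀ p q → b p ≡ just i → b q ≡ just i → p ≡ q) × b Fin.zero ≢ just i) →
              ∀ i → InC⁻ G i → Odd i → (∀ p q → c p ≡ just i → c q ≡ just i → p ≡ q) × c Fin.zero ≢ just i
  concise-c concise i i∈C⁻ odd = unique , not-at-0
    where
    unique : ∀ p q → c p ≡ just i → c q ≡ just i → p ≡ q
    unique p q cp≡i cq≡i with c-just p cp≡i | c-just q cq≡i
    ... | inj₁ (_ , refl , _)  | inj₁ (_ , refl , _)  = refl
    ... | inj₁ (refl , _)      | inj₂ (_ , _ , d<d)   = ⊥-elim (<-irrefl refl d<d)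
    ... | inj₂ (_ , _ , d<d)   | inj₁ (refl , _)      = ⊥-elim (<-irrefl refl d<d)
    ... | inj₂ (_ , bp≡i , _)  | inj₂ (_ , bq≡i , _)  = proj₁ (concise i i∈C⁻ odd) p q bp≡i bq≡i
    not-at-0 : c Fin.zero ≢ just i
    not-at-0 c0≡i with c-just Fin.zero c0≡i
    ... | inj₁ (_ , 0≡j , j≢0) = j≢0 (sym 0≡j)
    ... | inj₂ (() , _)

  ℓ-new : (ℕ → ℕ) → ℕ → ℕ
  ℓ-new ℓ = update d (ℓ e) ℓ

  module Lengths (e∈C⁻ : InC⁻ G e) (ℓ : ℕ → ℕ) (length-b : ∀ i → InC⁻ G i → B.pow i ≤ B.len ℓ i) where

    ℓ' : ℕ → ℕ
    ℓ' = ℓ-new ℓ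

    ℓ'-above : ∀ {x} → d < x → ℓ' x ≡ ℓ x
    ℓ'-above d<x = update-other (ℓ e) ℓ (>⇒≢ d<x)

    length-above : ∀ {i} → InC⁻ G i → d < i → C.pow i ≤ C.len ℓ' i
    length-above {i} i∈C⁻ d<i = begin
      C.pow i       ≤⟨ CB.powSum-mono P⊆P ⟩
      B.pow i       ≤⟨ length-b i i∈C⁻ ⟩
      B.len ℓ i     ≤⟨ BC.lenSum-mono ℓ ℓ' U⊆U ⟩
      C.len ℓ' i    ∎
      where
      open ≤-Reasoning
      P⊆P : ∀ p → C.InP i p → B.InP i p
      P⊆P p (x , cp≡x , u) with c-just p cp≡x
      ... | inj₁ (refl , _)     = contradiction (trans (sym u) (C.inU-below d<i)) λ ()
      ... | inj₂ (_ , bp≡x , _) = x , bp≡x , trans (sym (inU-above x d<i)) u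
      U⊆U : ∀ x → B.inU i x ≡ true → C.inU i x ≡ true × ℓ x ≤ ℓ' x
      U⊆U x u = trans (inU-above x d<i) u , ≤-reflexive (sym (ℓ'-above (<-≤-trans d<i (B.inU⇒≤ u))))

    length-j≡0 : j ≡ Fin.zero → ∀ {i} → i ≤ d → C.pow i ≤ C.len ℓ' i
    length-j≡0 j≡0 {i} i≤d = begin
      C.pow i           ≤⟨ CB.powSum-mono P⊆P ⟩
      B.pow (suc d)     ≤⟨ length-b (suc d) suc-d∈C⁻ ⟩
      B.len ℓ (suc d)   ≤⟨ BC.lenSum-mono ℓ ℓ' U⊆U ⟩
      C.len ℓ' i        ∎
      where
      open ≤-Reasoning
      P⊆P : ∀ p → C.InP i p → B.InP (suc d) p
      P⊆P p (x , cp≡x , u) with c-just p cp≡x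
      ... | inj₁ (_ , _ , j≢0)  = ⊥-elim (j≢0 j≡0)
      ... | inj₂ (_ , bp≡x , _) = x , bp≡x , trans (sym (inU-j≡0 j≡0 i≤d x)) u
      U⊆U : ∀ x → B.inU (suc d) x ≡ true → C.inU i x ≡ true × ℓ x ≤ ℓ' x
      U⊆U x u = trans (inU-j≡0 j≡0 i≤d x) u , ≤-reflexive (sym (ℓ'-above (B.inU⇒≤ u)))

    length-j≢0-below : j ≢ Fin.zero → ∀ {i} → i < d → C.pow i ≤ C.len ℓ' i
    length-j≢0-below j≢0 {i} i<d = subst (_≤ C.len ℓ' i) (sym (C.powSum-zero none)) z≤n
      where
      none : ∀ p → ¬ C.InP i p
      none p (x , cp≡x , u) = contradiction (trans (sym u) (inU-j≢0 j≢0 i<d (c-occurs⇒d≤ (p , cp≡x)))) λ ()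

    -- No colour of b lies in (e,d] and no colour of c lies below d, so U(e,b)
    -- and U(d,c) agree above d; the term of e on the left is matched with the
    -- term of d on the right.
    length-at-d : j ≢ Fin.zero → C.pow d ≤ C.len ℓ' d
    length-at-d j≢0 = begin
      C.pow d       ≤⟨ CB.powSum-mono P⊆P ⟩
      B.pow e       ≤⟨ length-b e e∈C⁻ ⟩
      B.len ℓ e     ≤⟨ sumUpTo-≤-matching (B.lenTerm ℓ e) (C.lenTerm ℓ' d)
                         (s≤s (≤-trans e≤d (<⇒≤ d<maxC))) (s≤s (<⇒≤ d<maxC)) e-matches-d rest ⟩
      C.len ℓ' d    ∎
      where
      open ≤-Reasoning
      e∈U : B.inU e e ≡ true
      e∈U = B.inU-refl (B.occ-true (j , bj≡e))
      P⊆P : ∀ p → C.InP d p → B.InP e p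
      P⊆P p (x , cp≡x , u) with c-just p cp≡x
      ... | inj₁ (refl , refl , _) = e , bj≡e , e∈U
      ... | inj₂ (_ , bp≡x , d<x)  = x , bp≡x , trans (sym (inU-d d<x)) u
      e-matches-d : B.lenTerm ℓ e e ≤ C.lenTerm ℓ' d d
      e-matches-d = ≤-reflexive (trans (B.lenTerm-∈ ℓ e∈U)
        (sym (trans (C.lenTerm-∈ ℓ' (C.inU-refl (occ-c-d j≢0))) (update-same d (ℓ e) ℓ))))
      below-d : ∀ {x} → x ≢ e → x ≤ d → B.inU e x ≡ false
      below-d {x} x≢e x≤d with x <? e
      ... | yes x<e = B.inU-below x<e
      ... | no x≮e  = B.inU-unoccurring (occ-b-between (≤∧≢⇒< (≮⇒≥ x≮e) (x≢e ∘ sym)) x≤d)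
      rest : ∀ x → update e 0 (B.lenTerm ℓ e) x ≤ update d 0 (C.lenTerm ℓ' d) x
      rest x with x ≟ e
      ... | yes refl = ≤-trans (≤-reflexive (update-same x 0 (B.lenTerm ℓ e))) z≤n
      ... | no x≢e with x ≤? d
      ...   | yes x≤d = ≤-trans (≤-reflexive (trans (update-other 0 (B.lenTerm ℓ e) x≢e) (B.lenTerm-∉ ℓ (below-d x≢e x≤d)))) z≤n
      ...   | no x≰d  = ≤-reflexive (begin-equality
        update e 0 (B.lenTerm ℓ e) x    ≡⟨ update-other 0 (B.lenTerm ℓ e) x≢e ⟩
        B.lenTerm ℓ e x                 ≡⟨ cong₂ (λ t n → if t then n else 0) (sym (inU-d d<x)) (sym (ℓ'-above d<x)) ⟩
        C.lenTerm ℓ' d x                ≡⟨ sym (update-other 0 (C.lenTerm ℓ' d) (>⇒≢ d<x)) ⟩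
        update d 0 (C.lenTerm ℓ' d) x   ∎)
        where
        d<x : d < x
        d<x = ≰⇒> x≰d

    length-c : ∀ i → InC⁻ G i → C.pow i ≤ C.len ℓ' i
    length-c i i∈C⁻ with <-cmp d i | newWitness-at b d j
    ... | tri< d<i _ _  | _              = length-above i∈C⁻ d<i
    ... | tri≈ _ refl _ | inj₁ (j≡0 , _) = length-j≡0 j≡0 ≤-refl
    ... | tri≈ _ refl _ | inj₂ (j≢0 , _) = length-at-d j≢0
    ... | tri> _ _ i<d  | inj₁ (j≡0 , _) = length-j≡0 j≡0 (<⇒≤ i<d)
    ... | tri> _ _ i<d  | inj₂ (j≢0 , _) = length-j≢0-below j≢0 i<d

  module Witnesses (ℓ : ℕ → ℕ) (W : ℕ → List ℕ)
    (witness-b : ∀ i → B.Occ i → IsColourWitnessOf G m ρ i (ℓ i) (W i))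
    (ordered-b : ∀ i i' → i' < i → B.Occ i → B.Occ i' →
                 ∀ xs x y ys → W i ≡ xs ++ [ x ] → W i' ≡ y ∷ ys → x < y)
    where

    closed : ∃[ ps ] IsColourWitnessOf G (suc m) ρ' d (ℓ e) ps
                   × (∀ y ys → ps ≡ y ∷ ys → y ≡ suc m ⊎ ∃[ zs ] W e ≡ y ∷ zs)
    closed = witnessOf-close d-odd e≤d (witness-b e (j , bj≡e))

    W' : ℕ → List ℕ
    W' = update d (proj₁ closed) W

    W'-above : ∀ {i} → d < i → W' i ≡ W i
    W'-above d<i = update-other _ W (>⇒≢ d<i)

    witness-c : ∀ i → C.Occ i → IsColourWitnessOf G (suc m) ρ' i (ℓ-new ℓ i) (W' i)
    witness-c i o with c-occurs o
    ... | inj₁ (refl , _) = subst₂ (IsColourWitnessOf G (suc m) ρ' d)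
            (sym (update-same d (ℓ e) ℓ)) (sym (update-same d _ W)) (proj₁ (proj₂ closed))
    ... | inj₂ (d<i , o') = subst₂ (IsColourWitnessOf G (suc m) ρ' i)
            (sym (update-other (ℓ e) ℓ (>⇒≢ d<i))) (sym (W'-above d<i)) (witnessOf-extend (<⇒≤ d<i) (witness-b i o'))

    last≤m : ∀ {i} → B.Occ i → ∀ xs x → W i ≡ xs ++ [ x ] → x ≤ m
    last≤m o xs x Wi≡ = proj₂ (All.head (++⁻ʳ xs (subst (All (InRange m)) Wi≡ (proj₁ (proj₂ (proj₂ (witness-b _ o)))))))

    ordered-c : ∀ i i' → i' < i → C.Occ i → C.Occ i' →
                ∀ xs x y ys → W' i ≡ xs ++ [ x ] → W' i' ≡ y ∷ ys → x < y
    ordered-c i i' i'<i oi oi' xs x y ys W'i≡ W'i'≡ with c-occurs oi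
    ... | inj₁ (refl , _) = ⊥-elim (<⇒≱ i'<i (c-occurs⇒d≤ oi'))
    ... | inj₂ (d<i , oi-b) with c-occurs oi'
    ...   | inj₂ (d<i' , oi'-b) =
      ordered-b i i' i'<i oi-b oi'-b xs x y ys (trans (sym (W'-above d<i)) W'i≡) (trans (sym (W'-above d<i')) W'i'≡)
    ...   | inj₁ (refl , _) with proj₂ (proj₂ closed) y ys (trans (sym (update-same d _ W)) W'i'≡)
    ...     | inj₁ refl       = s≤s (last≤m oi-b xs x (trans (sym (W'-above d<i)) W'i≡))
    ...     | inj₂ (zs , We≡) =
      ordered-b i e (≤-<-trans e≤d d<i) oi-b (j , bj≡e) xs x y zs (trans (sym (W'-above d<i)) W'i≡) We≡

-- The play-prefix and edge hypotheses are unused: colour witnesses refer only to colours and positions.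
lemma8 : (G : ParityGame) (m : ℕ) (ρ : ℕ → V G) (v : V G) →
         IsPlayPrefix G m ρ → ParityGame.E G (ρ m) v →
         InC⁻ G (ParityGame.φ G v) → Odd (ParityGame.φ G v) →
         (k : ℕ) (b : Fin (suc k) → Maybe ℕ) →
         IsColourWitness G m ρ k b →
         (j : Fin (suc k)) →
         (∃[ c ] (b j ≡ just c × c ≤ ParityGame.φ G v)) →
         (∀ i → j <ᶠ i → b i ≡ nothing ⊎ ∃[ c ] (b i ≡ just c × ParityGame.φ G v < c)) →
         IsColourWitness G (suc m) (extend G ρ m v) k (newWitness b j (ParityGame.φ G v))
lemma8 G m ρ v _ _ d∈C⁻ d-odd k b (entries , order , concise , ℓ , W , witness , ordered , length) j (e , bj≡e , e≤d) above =
  entries-c entries , order-c , concise-c concise , ℓ-new ℓ , W' , witness-c , ordered-c , length-c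
  where
  open NewWitness G m ρ v d∈C⁻ d-odd k b order j e bj≡e e≤d above
  open Witnesses ℓ W witness ordered
  open Lengths (entries j e bj≡e) ℓ length
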